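{- Let $S\subseteq\mathbb{F}_2^n$ be a Sidon set and let $p\in\mathbb{F}_2^n\setminus S$. In $\mathrm{Cay}(\gamma_S)$, the vertex $p$ is adjacent to exactly $3\,\mathrm{mult}_S(p)$ vertices belonging to $S$.
   Context: A set $S\subseteq\mathbb{F}_2^n$ is Sidon if whenever $a+b=c+d$ with $a,b,c,d\in S$, $a\neq b$, $c\neq d$, then $\{a,b\}=\{c,d\}$. $\mathrm{mult}_S(p)$ is the number of $3$-element subsets $\{x,y,z\}\subseteq S$ with $x+y+z=p$. $\gamma_S(a)=1$ if $a\neq0$ and $(a+S)\cap S\neq\emptyset$, else $0$; $\mathrm{Cay}(f)$ has vertex set $\mathbb{F}_2^n$ and edges $\{u,v\}$ with $f(u+v)=1$. -}

module Defs where

open import Data.Bool using (Bool; true; false; _xor_; _∧_; not; if_then_else_)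
open import Data.Vec using (Vec; []; _∷_; zipWith; replicate)
open import Data.List using (List; []; _∷_; _++_; map; concatMap; filterᵇ; length)
open import Data.Bool.ListAction using (any)
open import Data.Product using (_×_; _,_)
open import Data.Sum using (_⊎_)
open import Data.Nat using (ℕ; zero; suc)
open import Relation.Binary.PropositionalEquality using (_≡_; _≢_)
open import Relation.Nullary.Decidable using (⌊_⌋)
import Data.Vec.Properties as VP
import Data.Bool.Properties as BP

-- Vectors of 𝔽₂ⁿ, with 𝔽₂ modelled by Bool and addition by xor.
V : ℕ → Set
V n = Vec Bool n

infixl 6 _⊕_
_⊕_ : ∀ {n} → V n → V n → V n
_⊕_ = zipWith _xor_

𝟎 : ∀ {n} → V n
𝟎 = replicate _ false

_==_ : ∀ {n} → V n → V n → Bool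
u == v = ⌊ VP.≡-dec BP._≟_ u v ⌋

allV : (n : ℕ) → List (V n)
allV zero = [] ∷ []
allV (suc n) = map (false ∷_) (allV n) ++ map (true ∷_) (allV n)

-- A subset S ⊆ 𝔽₂ⁿ is given by its (Boolean) characteristic function.
Subset : ℕ → Set
Subset n = V n → Bool

Sidon : ∀ {n} → Subset n → Set
Sidon {n} S = ∀ (a b c d : V n) → S a ≡ true → S b ≡ true → S c ≡ true → S d ≡ true →
  a ≢ b → c ≢ d → a ⊕ b ≡ c ⊕ d → (a ≡ c × b ≡ d) ⊎ (a ≡ d × b ≡ c)

-- all triples (x_i, x_j, x_k) with i < j < k of positions in a list;
-- for a duplicate-free list this lists every 3-element subset exactly once
triples : ∀ {A : Set} → List A → List (A × A × A)
pairsWith : ∀ {A : Set} → A → List A → List (A × A × A)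
pairs : ∀ {A : Set} → List A → List (A × A)
pairs [] = []
pairs (x ∷ xs) = map (x ,_) xs ++ pairs xs
pairsWith x xs = map (λ { (y , z) → x , y , z }) (pairs xs)
triples [] = []
triples (x ∷ xs) = pairsWith x xs ++ triples xs

mult : ∀ {n} → Subset n → V n → ℕ
mult {n} S p = length (filterᵇ (λ { (x , y , z) → S x ∧ S y ∧ S z ∧ ((x ⊕ y ⊕ z) == p) }) (triples (allV n)))

γ : ∀ {n} → Subset n → V n → Bool
γ {n} S a = not (a == 𝟎) ∧ any (λ s → S s ∧ S (a ⊕ s)) (allV n)

Adj : ∀ {n} → (V n → Bool) → V n → V n → Bool
Adj f u v = f (u ⊕ v)

neighboursIn : ∀ {n} → (V n → Bool) → Subset n → V n → ℕ
neighboursIn {n} f S p = length (filterᵇ (λ v → S v ∧ Adj f p v) (allV n))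

{-# OPTIONS --safe #-}
module Submission where

-- Count the ordered triples (a , b , c) ∈ S³ with a + b + c = p in two ways. Since p ∉ S
-- their entries are pairwise distinct, so there are 6 · mult_S(p) of them. For fixed a ∈ S
-- the pairs (b , c) are the ordered ways of writing p + a ≠ 0 as a sum of two elements of S;
-- by the Sidon property there are exactly two of them if γ_S(p + a) = 1 and none otherwise.
-- Hence 6 · mult_S(p) = 2 · #{a ∈ S : γ_S(p + a) = 1}.

open import Defs
open import Algebra.Bundles using (CommutativeMonoid)
open import Data.Bool using (Bool; true; false; _∧_; not)
open import Data.Bool.ListAction using (any)
open import Data.Bool.Properties
  using (∧-commutativeMonoid; ∧-comm; ∧-zeroʳ; ∧-identityʳ; ¬-not; ⇔→≡;
         xor-comm; xor-assoc; xor-identityˡ; xor-identityʳ; xor-same)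
  renaming (_≟_ to _≟ᵇ_)
open import Data.Empty using (⊥-elim)
open import Data.List using (List; []; _∷_; _++_; map; filterᵇ; length)
open import Data.List.Properties using (map-++; map-∘; map-cong)
open import Data.Nat using (ℕ; zero; suc; _+_; _*_)
open import Data.Nat.ListAction using (sum)
open import Data.Nat.ListAction.Properties using (sum-++)
open import Data.Nat.Properties using (+-identityʳ; *-zeroʳ; *-distribˡ-+; *-assoc; *-cancelˡ-≡)
open import Data.Nat.Tactic.RingSolver using (solve-∀)
open import Data.Product using (_×_; _,_; ∃; proj₁; uncurry)
open import Data.Sum using (_⊎_; inj₁; inj₂; [_,_])
import Data.Sum as Sum
open import Data.Vec using ([]; _∷_)
open import Data.Vec.Properties
  using (≡-dec; ∷-injectiveˡ; ∷-injectiveʳ; map-id;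
         zipWith-comm; zipWith-assoc; zipWith-identityˡ; zipWith-identityʳ; zipWith-inverseˡ)
open import Function using (_∘_; _⇔_; mk⇔; Equivalence)
import Function.Properties.Equivalence as ⇔
open import Relation.Binary.PropositionalEquality
  using (_≡_; _≢_; refl; sym; trans; cong; cong₂; module ≡-Reasoning)
open import Relation.Nullary using (yes; no)
open import Algebra.Properties.CommutativeSemigroup (CommutativeMonoid.commutativeSemigroup ∧-commutativeMonoid)
  using () renaming (x∙yz≈y∙xz to ∧-left-comm)

private variable
  A B : Set
  n m : ℕ

𝟙 : Bool → ℕ
𝟙 true  = 1
𝟙 false = 0

∑ : {A : Set} → List A → (A → ℕ) → ℕ
∑ xs f = sum (map f xs)

syntax ∑ xs (λ x → e) = ∑[ x ∈ xs ] e

∑-cong : ∀ {f g : A → ℕ} xs → (∀ x → f x ≡ g x) → ∑ xs f ≡ ∑ xs g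
∑-cong xs f≗g = cong sum (map-cong f≗g xs)

∑-++ : ∀ (f : A → ℕ) xs ys → ∑ (xs ++ ys) f ≡ ∑ xs f + ∑ ys f
∑-++ f xs ys = trans (cong sum (map-++ f xs ys)) (sum-++ (map f xs) (map f ys))

∑-map : ∀ (f : B → ℕ) (g : A → B) xs → ∑ (map g xs) f ≡ ∑ xs (f ∘ g)
∑-map f g xs = cong sum (sym (map-∘ xs))

∑-zero : ∀ {f : A → ℕ} xs → (∀ x → f x ≡ 0) → ∑ xs f ≡ 0
∑-zero []       f≗0 = refl
∑-zero (x ∷ xs) f≗0 = cong₂ _+_ (f≗0 x) (∑-zero xs f≗0)

∑-+ : ∀ (f g : A → ℕ) xs → ∑[ x ∈ xs ] (f x + g x) ≡ ∑ xs f + ∑ xs g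
∑-+ f g []       = refl
∑-+ f g (x ∷ xs) = trans (cong (f x + g x +_) (∑-+ f g xs)) (interchange (f x) (g x) _ _)
  where
  interchange : ∀ a b c d → a + b + (c + d) ≡ a + c + (b + d)
  interchange = solve-∀

∑-*ˡ : ∀ k (f : A → ℕ) xs → ∑[ x ∈ xs ] (k * f x) ≡ k * ∑ xs f
∑-*ˡ k f []       = sym (*-zeroʳ k)
∑-*ˡ k f (x ∷ xs) = trans (cong (k * f x +_) (∑-*ˡ k f xs)) (sym (*-distribˡ-+ k (f x) (∑ xs f)))

length-filterᵇ : ∀ (P : A → Bool) xs → length (filterᵇ P xs) ≡ ∑[ x ∈ xs ] 𝟙 (P x)
length-filterᵇ P []       = refl
length-filterᵇ P (x ∷ xs) with P x
... | true  = cong suc (length-filterᵇ P xs)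
... | false = length-filterᵇ P xs

∑-𝟙-¬any : ∀ (P : A → Bool) xs → any P xs ≡ false → ∑[ x ∈ xs ] 𝟙 (P x) ≡ 0
∑-𝟙-¬any P []       _ = refl
∑-𝟙-¬any P (x ∷ xs) ¬any with P x
... | false = ∑-𝟙-¬any P xs ¬any

any-witness : ∀ (P : A → Bool) xs → any P xs ≡ true → ∃ λ x → P x ≡ true
any-witness P (x ∷ xs) any≡true with P x in Px
... | true  = x , Px
... | false = any-witness P xs any≡true

∑∑-∷ : ∀ (F : A → A → ℕ) x xs →
  ∑[ a ∈ x ∷ xs ] ∑[ b ∈ x ∷ xs ] F a b
    ≡ F x x + (∑[ b ∈ xs ] F x b + ∑[ a ∈ xs ] F a x) + ∑[ a ∈ xs ] ∑[ b ∈ xs ] F a b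
∑∑-∷ F x xs =
  trans (cong (F x x + ∑ xs (F x) +_) (∑-+ (λ a → F a x) (λ a → ∑ xs (F a)) xs))
        (regroup (F x x) _ _ _)
  where
  regroup : ∀ a b c d → a + b + (c + d) ≡ a + (b + c) + d
  regroup = solve-∀

∑-pairs-∷ : ∀ (G : A × A → ℕ) x xs →
  ∑ (pairs (x ∷ xs)) G ≡ ∑[ b ∈ xs ] G (x , b) + ∑ (pairs xs) G
∑-pairs-∷ G x xs =
  trans (∑-++ G (map (x ,_) xs) (pairs xs)) (cong (_+ ∑ (pairs xs) G) (∑-map G (x ,_) xs))

module _ (F : A → A → ℕ) (F-comm : ∀ a b → F a b ≡ F b a) (F-diag : ∀ a → F a a ≡ 0) where

  ∑∑≡2*∑-pairs : ∀ xs → ∑[ a ∈ xs ] ∑[ b ∈ xs ] F a b ≡ 2 * ∑ (pairs xs) (uncurry F)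
  ∑∑≡2*∑-pairs []       = refl
  ∑∑≡2*∑-pairs (x ∷ xs) = begin
    ∑[ a ∈ x ∷ xs ] ∑[ b ∈ x ∷ xs ] F a b
      ≡⟨ ∑∑-∷ F x xs ⟩
    F x x + (row + ∑[ a ∈ xs ] F a x) + rest
      ≡⟨ cong₂ (λ d r → d + (row + r) + rest) (F-diag x) (∑-cong xs (λ a → F-comm a x)) ⟩
    0 + (row + row) + rest
      ≡⟨ cong (0 + (row + row) +_) (∑∑≡2*∑-pairs xs) ⟩
    0 + (row + row) + 2 * ∑ (pairs xs) (uncurry F)
      ≡⟨ double row _ ⟩
    2 * (row + ∑ (pairs xs) (uncurry F))
      ≡⟨ cong (2 *_) (∑-pairs-∷ (uncurry F) x xs) ⟨
    2 * ∑ (pairs (x ∷ xs)) (uncurry F) ∎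
    where
    open ≡-Reasoning
    row  = ∑ xs (F x)
    rest = ∑[ a ∈ xs ] ∑[ b ∈ xs ] F a b
    double : ∀ u v → 0 + (u + u) + 2 * v ≡ 2 * (u + v)
    double = solve-∀

module _ (F : A × A × A → ℕ)
  (F-swap₁₂ : ∀ a b c → F (a , b , c) ≡ F (b , a , c))
  (F-swap₂₃ : ∀ a b c → F (a , b , c) ≡ F (a , c , b))
  (F-diag : ∀ a c → F (a , a , c) ≡ 0) where

  private
    slice : A → List A → ℕ
    slice a xs = ∑[ b ∈ xs ] ∑[ c ∈ xs ] F (a , b , c)

    F-diag₁₃ : ∀ a b → F (a , b , a) ≡ 0
    F-diag₁₃ a b = trans (F-swap₂₃ a b a) (F-diag a b)

    F-diag₂₃ : ∀ a b → F (b , a , a) ≡ 0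
    F-diag₂₃ a b = trans (F-swap₁₂ b a a) (F-diag₁₃ a b)

    slice-∷-head : ∀ x xs → slice x (x ∷ xs) ≡ slice x xs
    slice-∷-head x xs = begin
      slice x (x ∷ xs)
        ≡⟨ ∑∑-∷ (λ b c → F (x , b , c)) x xs ⟩
      F (x , x , x) + (∑[ c ∈ xs ] F (x , x , c) + ∑[ b ∈ xs ] F (x , b , x)) + slice x xs
        ≡⟨ cong₂ (λ d r → d + r + slice x xs) (F-diag x x)
             (cong₂ _+_ (∑-zero xs (F-diag x)) (∑-zero xs (F-diag₁₃ x))) ⟩
      slice x xs ∎
      where open ≡-Reasoning

    -- x sits in the second or in the third place, and both give ∑ F (x , a , _) by symmetry
    slice-∷-tail : ∀ x xs a → slice a (x ∷ xs) ≡ 2 * ∑[ c ∈ xs ] F (x , a , c) + slice a xs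
    slice-∷-tail x xs a = begin
      slice a (x ∷ xs)
        ≡⟨ ∑∑-∷ (λ b c → F (a , b , c)) x xs ⟩
      F (a , x , x) + (∑[ c ∈ xs ] F (a , x , c) + ∑[ b ∈ xs ] F (a , b , x)) + slice a xs
        ≡⟨ cong₂ (λ d r → d + r + slice a xs) (F-diag₂₃ x a)
             (cong₂ _+_ (∑-cong xs (F-swap₁₂ a x))
                        (∑-cong xs (λ b → trans (F-swap₂₃ a b x) (F-swap₁₂ a x b)))) ⟩
      0 + (column + column) + slice a xs
        ≡⟨ double column (slice a xs) ⟩
      2 * column + slice a xs ∎
      where
      open ≡-Reasoning
      column = ∑[ c ∈ xs ] F (x , a , c)
      double : ∀ u v → 0 + (u + u) + v ≡ 2 * u + v
      double = solve-∀

  ∑∑∑≡6*∑-triples : ∀ xs →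
    ∑[ a ∈ xs ] ∑[ b ∈ xs ] ∑[ c ∈ xs ] F (a , b , c) ≡ 6 * ∑ (triples xs) F
  ∑∑∑≡6*∑-triples []       = refl
  ∑∑∑≡6*∑-triples (x ∷ xs) = begin
    slice x (x ∷ xs) + ∑[ a ∈ xs ] slice a (x ∷ xs)
      ≡⟨ cong₂ _+_ (slice-∷-head x xs) (∑-cong xs (slice-∷-tail x xs)) ⟩
    slice x xs + ∑[ a ∈ xs ] (2 * ∑[ c ∈ xs ] F (x , a , c) + slice a xs)
      ≡⟨ cong (slice x xs +_) (∑-+ (λ a → 2 * ∑[ c ∈ xs ] F (x , a , c)) (λ a → slice a xs) xs) ⟩
    slice x xs + (∑[ a ∈ xs ] (2 * ∑[ c ∈ xs ] F (x , a , c)) + ∑[ a ∈ xs ] slice a xs)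
      ≡⟨ cong (λ s → slice x xs + (s + _)) (∑-*ˡ 2 (λ a → ∑[ c ∈ xs ] F (x , a , c)) xs) ⟩
    slice x xs + (2 * slice x xs + ∑[ a ∈ xs ] slice a xs)
      ≡⟨ cong₂ (λ s t → s + (2 * s + t)) slice-x (∑∑∑≡6*∑-triples xs) ⟩
    2 * P + (2 * (2 * P) + 6 * ∑ (triples xs) F)
      ≡⟨ sextuple P _ ⟩
    6 * (P + ∑ (triples xs) F)
      ≡⟨ cong (λ s → 6 * (s + ∑ (triples xs) F)) (∑-map F _ (pairs xs)) ⟨
    6 * (∑ (pairsWith x xs) F + ∑ (triples xs) F)
      ≡⟨ cong (6 *_) (∑-++ F (pairsWith x xs) (triples xs)) ⟨
    6 * ∑ (triples (x ∷ xs)) F ∎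
    where
    open ≡-Reasoning
    P = ∑ (pairs xs) (λ (b , c) → F (x , b , c))
    slice-x : slice x xs ≡ 2 * P
    slice-x = ∑∑≡2*∑-pairs (λ b c → F (x , b , c)) (F-swap₂₃ x) (λ b → F-diag₂₃ b x) xs
    sextuple : ∀ u v → 2 * u + (2 * (2 * u) + 6 * v) ≡ 6 * (u + v)
    sextuple = solve-∀

⊕-comm : (u v : V n) → u ⊕ v ≡ v ⊕ u
⊕-comm = zipWith-comm xor-comm

⊕-assoc : (u v w : V n) → u ⊕ v ⊕ w ≡ u ⊕ (v ⊕ w)
⊕-assoc = zipWith-assoc xor-assoc

⊕-identityˡ : (u : V n) → 𝟎 ⊕ u ≡ u
⊕-identityˡ = zipWith-identityˡ xor-identityˡ

⊕-identityʳ : (u : V n) → u ⊕ 𝟎 ≡ u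
⊕-identityʳ = zipWith-identityʳ xor-identityʳ

⊕-self : (u : V n) → u ⊕ u ≡ 𝟎
⊕-self u = trans (cong (_⊕ u) (sym (map-id u))) (zipWith-inverseˡ xor-same u)

⊕-cancelˡ : (u v : V n) → u ⊕ (u ⊕ v) ≡ v
⊕-cancelˡ u v = begin
  u ⊕ (u ⊕ v) ≡⟨ ⊕-assoc u u v ⟨
  u ⊕ u ⊕ v   ≡⟨ cong (_⊕ v) (⊕-self u) ⟩
  𝟎 ⊕ v       ≡⟨ ⊕-identityˡ v ⟩
  v           ∎
  where open ≡-Reasoning

⊕-moveˡ : ∀ {u v w : V n} → u ⊕ v ≡ w → v ≡ u ⊕ w
⊕-moveˡ {u = u} {v = v} u⊕v≡w = trans (sym (⊕-cancelˡ u v)) (cong (u ⊕_) u⊕v≡w)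

≢𝟎⇒≢⊕ : ∀ {c : V n} → c ≢ 𝟎 → ∀ u → u ≢ c ⊕ u
≢𝟎⇒≢⊕ {c = c} c≢𝟎 u u≡c⊕u =
  c≢𝟎 (trans (⊕-moveˡ (trans (⊕-comm u c) (sym u≡c⊕u))) (⊕-self u))

⊕≡𝟎⇒≡ : ∀ {u v : V n} → u ⊕ v ≡ 𝟎 → u ≡ v
⊕≡𝟎⇒≡ {u = u} u⊕v≡𝟎 = sym (trans (⊕-moveˡ u⊕v≡𝟎) (⊕-identityʳ u))

==⇔≡ : ∀ {u v : V n} → (u == v) ≡ true ⇔ u ≡ v
==⇔≡ {u = u} {v = v} with ≡-dec _≟ᵇ_ u v
... | yes u≡v = mk⇔ (λ _ → u≡v) (λ _ → refl)
... | no  u≢v = mk⇔ (λ ()) (λ u≡v → ⊥-elim (u≢v u≡v))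

==-refl : (u : V n) → (u == u) ≡ true
==-refl u = Equivalence.from ==⇔≡ refl

==-false : ∀ {u v : V n} → u ≢ v → (u == v) ≡ false
==-false u≢v = ¬-not (u≢v ∘ Equivalence.to ==⇔≡)

==-cong : {u v : V n} {u′ v′ : V m} → u ≡ v ⇔ u′ ≡ v′ → (u == v) ≡ (u′ == v′)
==-cong u≡v⇔u′≡v′ = ⇔→≡ (⇔.trans (⇔.trans ==⇔≡ u≡v⇔u′≡v′) (⇔.sym ==⇔≡))

⊕-==-flip : ∀ {w t p : V n} → ((w ⊕ t) == p) ≡ (t == (w ⊕ p))
⊕-==-flip {w = w} {p = p} =
  ==-cong (mk⇔ ⊕-moveˡ (λ t≡w⊕p → trans (cong (w ⊕_) t≡w⊕p) (⊕-cancelˡ w p)))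

==-∷-same : ∀ {x} {u v : V n} → ((x ∷ u) == (x ∷ v)) ≡ (u == v)
==-∷-same = ==-cong (mk⇔ ∷-injectiveʳ (cong (_ ∷_)))

==-∷-other : ∀ {x y} {u v : V n} → x ≢ y → ((x ∷ u) == (y ∷ v)) ≡ false
==-∷-other x≢y = ==-false (x≢y ∘ ∷-injectiveˡ)

∑-allV-suc : (f : V (suc n) → ℕ) →
  ∑ (allV (suc n)) f ≡ ∑[ t ∈ allV n ] f (false ∷ t) + ∑[ t ∈ allV n ] f (true ∷ t)
∑-allV-suc {n} f =
  trans (∑-++ f (map (false ∷_) (allV n)) (map (true ∷_) (allV n)))
        (cong₂ _+_ (∑-map f (false ∷_) (allV n)) (∑-map f (true ∷_) (allV n)))

module _ (h : V n → Bool) (a : V n) (L : List (V n)) where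

  ∑-==-∷-same : ∀ x →
    ∑[ t ∈ L ] 𝟙 (h t ∧ ((x ∷ t) == (x ∷ a))) ≡ ∑[ t ∈ L ] 𝟙 (h t ∧ (t == a))
  ∑-==-∷-same x = ∑-cong L (λ t → cong (λ e → 𝟙 (h t ∧ e)) ==-∷-same)

  ∑-==-∷-other : ∀ x y → x ≢ y → ∑[ t ∈ L ] 𝟙 (h t ∧ ((x ∷ t) == (y ∷ a))) ≡ 0
  ∑-==-∷-other x y x≢y =
    ∑-zero L (λ t → trans (cong (λ e → 𝟙 (h t ∧ e)) (==-∷-other x≢y)) (cong 𝟙 (∧-zeroʳ (h t))))

∑-allV-sift : (h : V n → Bool) (a : V n) → ∑[ t ∈ allV n ] 𝟙 (h t ∧ (t == a)) ≡ 𝟙 (h a)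
∑-allV-sift {zero}  h []          = trans (+-identityʳ _) (cong 𝟙 (∧-identityʳ (h [])))
∑-allV-sift {suc n} h (false ∷ a) =
  trans (∑-allV-suc (λ t → 𝟙 (h t ∧ (t == (false ∷ a)))))
        (trans (cong₂ _+_ (trans (∑-==-∷-same (h ∘ (false ∷_)) a (allV n) false)
                                 (∑-allV-sift (h ∘ (false ∷_)) a))
                          (∑-==-∷-other (h ∘ (true ∷_)) a (allV n) true false (λ ())))
               (+-identityʳ _))
∑-allV-sift {suc n} h (true ∷ a)  =
  trans (∑-allV-suc (λ t → 𝟙 (h t ∧ (t == (true ∷ a)))))
        (cong₂ _+_ (∑-==-∷-other (h ∘ (false ∷_)) a (allV n) false true (λ ()))
                   (trans (∑-==-∷-same (h ∘ (true ∷_)) a (allV n) true)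
                          (∑-allV-sift (h ∘ (true ∷_)) a)))

∑-allV-sift-⊕ : (h : V n → Bool) (w p : V n) →
  ∑[ t ∈ allV n ] 𝟙 (h t ∧ ((w ⊕ t) == p)) ≡ 𝟙 (h (w ⊕ p))
∑-allV-sift-⊕ {n} h w p =
  trans (∑-cong (allV n) (λ t → cong (λ e → 𝟙 (h t ∧ e)) ⊕-==-flip)) (∑-allV-sift h (w ⊕ p))

∑-allV-two-points : (P : V n → Bool) {u v : V n} → u ≢ v →
  (∀ t → P t ≡ true ⇔ (t ≡ u ⊎ t ≡ v)) →
  ∑[ t ∈ allV n ] 𝟙 (P t) ≡ 2
∑-allV-two-points {n} P {u} {v} u≢v P⇔ = begin
  ∑[ t ∈ allV n ] 𝟙 (P t)
    ≡⟨ ∑-cong (allV n) (λ t → 𝟙-two (P⇔ t)) ⟩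
  ∑[ t ∈ allV n ] (𝟙 (t == u) + 𝟙 (t == v))
    ≡⟨ ∑-+ (λ t → 𝟙 (t == u)) (λ t → 𝟙 (t == v)) (allV n) ⟩
  ∑[ t ∈ allV n ] 𝟙 (t == u) + ∑[ t ∈ allV n ] 𝟙 (t == v)
    ≡⟨ cong₂ _+_ (∑-allV-sift (λ _ → true) u) (∑-allV-sift (λ _ → true) v) ⟩
  2 ∎
  where
  open ≡-Reasoning
  𝟙-two : ∀ {b t} → b ≡ true ⇔ (t ≡ u ⊎ t ≡ v) → 𝟙 b ≡ 𝟙 (t == u) + 𝟙 (t == v)
  𝟙-two {true} b⇔ with Equivalence.to b⇔ refl
  ... | inj₁ refl = sym (cong₂ (λ x y → 𝟙 x + 𝟙 y) (==-refl u) (==-false u≢v))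
  ... | inj₂ refl = sym (cong₂ (λ x y → 𝟙 x + 𝟙 y) (==-false (u≢v ∘ sym)) (==-refl v))
  𝟙-two {false} b⇔ =
    sym (cong₂ (λ x y → 𝟙 x + 𝟙 y) (==-false ((λ ()) ∘ Equivalence.from b⇔ ∘ inj₁))
                                   (==-false ((λ ()) ∘ Equivalence.from b⇔ ∘ inj₂)))

-- γ S c unfolds to  not (c == 𝟎) ∧ any (summand S c) (allV n)
summand : Subset n → V n → V n → Bool
summand S c s = S s ∧ S (c ⊕ s)

∧≡true⇒ : ∀ {x y} → x ∧ y ≡ true → x ≡ true × y ≡ true
∧≡true⇒ {true} {true} _ = refl , refl

module _ {n : ℕ} {S : Subset n} {c : V n} where

  summand-flip : ∀ {s} → summand S c s ≡ true → summand S c (c ⊕ s) ≡ true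
  summand-flip {s} s∈ =
    trans (cong (λ w → S (c ⊕ s) ∧ S w) (⊕-cancelˡ c s)) (trans (∧-comm (S (c ⊕ s)) (S s)) s∈)

  summand-unique : Sidon S → c ≢ 𝟎 → ∀ {s s₀} → summand S c s ≡ true → summand S c s₀ ≡ true →
    s ≡ s₀ ⊎ s ≡ c ⊕ s₀
  summand-unique sidon c≢𝟎 {s} {s₀} s∈ s₀∈
    with s∈S , c⊕s∈S ← ∧≡true⇒ s∈ | s₀∈S , c⊕s₀∈S ← ∧≡true⇒ s₀∈ =
    Sum.map proj₁ proj₁
      (sidon s (c ⊕ s) s₀ (c ⊕ s₀) s∈S c⊕s∈S s₀∈S c⊕s₀∈S (≢𝟎⇒≢⊕ c≢𝟎 s) (≢𝟎⇒≢⊕ c≢𝟎 s₀)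
             (trans (sum≡c s) (sym (sum≡c s₀))))
    where
    sum≡c : ∀ u → u ⊕ (c ⊕ u) ≡ c
    sum≡c u = trans (cong (u ⊕_) (⊕-comm c u)) (⊕-cancelˡ u c)

  Sidon⇒∑summand≡2*any : Sidon S → c ≢ 𝟎 →
    ∑[ s ∈ allV n ] 𝟙 (summand S c s) ≡ 2 * 𝟙 (any (summand S c) (allV n))
  Sidon⇒∑summand≡2*any sidon c≢𝟎 with any (summand S c) (allV n) in any≡
  ... | false = ∑-𝟙-¬any (summand S c) (allV n) any≡
  ... | true with s₀ , s₀∈ ← any-witness (summand S c) (allV n) any≡ =
    ∑-allV-two-points (summand S c) (≢𝟎⇒≢⊕ c≢𝟎 s₀)
      (λ s → mk⇔ (λ s∈ → summand-unique sidon c≢𝟎 s∈ s₀∈)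
                 [ (λ { refl → s₀∈ }) , (λ { refl → summand-flip s₀∈ }) ])

solution : Subset n → V n → V n × V n × V n → Bool
solution S p (x , y , z) = S x ∧ S y ∧ S z ∧ ((x ⊕ y ⊕ z) == p)

module _ {n : ℕ} {S : Subset n} {p : V n} where

  solution-swap₁₂ : ∀ a b c → solution S p (a , b , c) ≡ solution S p (b , a , c)
  solution-swap₁₂ a b c =
    trans (cong (λ w → S a ∧ S b ∧ S c ∧ ((w ⊕ c) == p)) (⊕-comm a b)) (∧-left-comm (S a) (S b) _)

  solution-swap₂₃ : ∀ a b c → solution S p (a , b , c) ≡ solution S p (a , c , b)
  solution-swap₂₃ a b c =
    trans (cong (λ w → S a ∧ S b ∧ S c ∧ (w == p)) swap) (cong (S a ∧_) (∧-left-comm (S b) (S c) _))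
    where
    swap : a ⊕ b ⊕ c ≡ a ⊕ c ⊕ b
    swap = trans (⊕-assoc a b c) (trans (cong (a ⊕_) (⊕-comm b c)) (sym (⊕-assoc a c b)))

  solution-diag : S p ≡ false → ∀ a c → solution S p (a , a , c) ≡ false
  solution-diag p∉S a c = begin
    S a ∧ S a ∧ S c ∧ ((a ⊕ a ⊕ c) == p)
      ≡⟨ cong (λ w → S a ∧ S a ∧ S c ∧ (w == p))
              (trans (cong (_⊕ c) (⊕-self a)) (⊕-identityˡ c)) ⟩
    S a ∧ S a ∧ S c ∧ (c == p)
      ≡⟨ cong (λ z → S a ∧ S a ∧ z) c∉S∨c≢p ⟩
    S a ∧ S a ∧ false
      ≡⟨ trans (cong (S a ∧_) (∧-zeroʳ (S a))) (∧-zeroʳ (S a)) ⟩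
    false ∎
    where
    open ≡-Reasoning
    c∉S∨c≢p : S c ∧ (c == p) ≡ false
    c∉S∨c≢p with c == p in c==p
    ... | false = ∧-zeroʳ (S c)
    ... | true  = trans (∧-identityʳ (S c)) (trans (cong S (Equivalence.to ==⇔≡ c==p)) p∉S)

  ∑∑∑-solution≡2*γ≡6*mult : S p ≡ false →
    ∑[ a ∈ allV n ] ∑[ b ∈ allV n ] ∑[ c ∈ allV n ] 𝟙 (solution S p (a , b , c)) ≡ 6 * mult S p
  ∑∑∑-solution≡2*γ≡6*mult p∉S =
    trans (∑∑∑≡6*∑-triples (𝟙 ∘ solution S p)
                           (λ a b c → cong 𝟙 (solution-swap₁₂ a b c))
                           (λ a b c → cong 𝟙 (solution-swap₂₃ a b c))
                           (λ a c → cong 𝟙 (solution-diag p∉S a c))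
                           (allV n))
          (cong (6 *_) (sym (length-filterᵇ (solution S p) (triples (allV n)))))

  -- solution is unfolded here so that `with S a` can abstract over S a
  ∑∑-solution≡2*γ : Sidon S → S p ≡ false → ∀ a →
    ∑[ b ∈ allV n ] ∑[ c ∈ allV n ] 𝟙 (S a ∧ S b ∧ S c ∧ ((a ⊕ b ⊕ c) == p))
      ≡ 2 * 𝟙 (S a ∧ γ S (p ⊕ a))
  ∑∑-solution≡2*γ sidon p∉S a with S a in a∈S
  ... | false = ∑-zero (allV n) (λ b → ∑-zero (allV n) (λ c → refl))
  ... | true  = begin
    ∑[ b ∈ allV n ] ∑[ c ∈ allV n ] 𝟙 (S b ∧ S c ∧ ((a ⊕ b ⊕ c) == p))
      ≡⟨ ∑-cong (allV n) completions ⟩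
    ∑[ b ∈ allV n ] 𝟙 (summand S (p ⊕ a) b)
      ≡⟨ Sidon⇒∑summand≡2*any sidon p⊕a≢𝟎 ⟩
    2 * 𝟙 (any (summand S (p ⊕ a)) (allV n))
      ≡⟨ cong (λ z → 2 * 𝟙 (not z ∧ any (summand S (p ⊕ a)) (allV n))) (==-false p⊕a≢𝟎) ⟨
    2 * 𝟙 (γ S (p ⊕ a)) ∎
    where
    open ≡-Reasoning
    p⊕a≢𝟎 : p ⊕ a ≢ 𝟎
    p⊕a≢𝟎 p⊕a≡𝟎 with () ← trans (sym p∉S) (trans (cong S (⊕≡𝟎⇒≡ p⊕a≡𝟎)) a∈S)
    completions : ∀ b →
      ∑[ c ∈ allV n ] 𝟙 (S b ∧ S c ∧ ((a ⊕ b ⊕ c) == p)) ≡ 𝟙 (S b ∧ S (p ⊕ a ⊕ b))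
    completions b with S b
    ... | false = ∑-zero (allV n) (λ _ → refl)
    ... | true  = trans (∑-allV-sift-⊕ S (a ⊕ b) p)
                        (cong (𝟙 ∘ S) (trans (⊕-comm (a ⊕ b) p) (sym (⊕-assoc p a b))))

proposition4p6 : (n : ℕ) (S : Subset n) → Sidon S → (p : V n) → S p ≡ false →
    neighboursIn (γ S) S p ≡ 3 * mult S p
proposition4p6 n S sidon p p∉S = *-cancelˡ-≡ _ _ 2 (begin
  2 * neighboursIn (γ S) S p
    ≡⟨ cong (2 *_) (length-filterᵇ (λ a → S a ∧ γ S (p ⊕ a)) (allV n)) ⟩
  2 * ∑[ a ∈ allV n ] 𝟙 (S a ∧ γ S (p ⊕ a))
    ≡⟨ ∑-*ˡ 2 (λ a → 𝟙 (S a ∧ γ S (p ⊕ a))) (allV n) ⟨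
  ∑[ a ∈ allV n ] (2 * 𝟙 (S a ∧ γ S (p ⊕ a)))
    ≡⟨ ∑-cong (allV n) (∑∑-solution≡2*γ sidon p∉S) ⟨
  ∑[ a ∈ allV n ] ∑[ b ∈ allV n ] ∑[ c ∈ allV n ] 𝟙 (solution S p (a , b , c))
    ≡⟨ ∑∑∑-solution≡2*γ≡6*mult {S = S} p∉S ⟩
  6 * mult S p
    ≡⟨ *-assoc 2 3 (mult S p) ⟩
  2 * (3 * mult S p) ∎)
  where open ≡-Reasoning
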